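{- Consider a single-use game of War played with WL-putback in which Alice starts with $m$ cards, and its win-loss forest with each node labelled by the two cards played in that round. Form a graph $H$ on all $n$ cards as follows: for each round $Q$, in which Bob plays card $y$, join $y$ by an edge to the card Bob played in the right parent of $Q$ if $Q$ has a right parent, and otherwise to the card of Alice's initial hand whose first round is the root of the tree containing $Q$. Then $H$ equals the game graph of the game.
   Context: War: $n$ cards $1,\dots,n$ split between Alice and Bob; in each round both reveal their top card and the owner of the higher card puts both at the bottom of their hand, under WL-putback the winning card first and the losing card second. A player with no cards loses. The game is single-use if Alice loses before Bob plays any card he won. The game graph has the $n$ cards as vertices and an edge joining the two cards played in each round. Win-loss forest: nodes are the rounds; for each card in Alice's initial hand, the first round in which it is played is a root; if $P$ is a round in which Alice's card $x$ beats Bob's card $y$, the next round in which $x$ plays is the left child of $P$ and the next round in which $y$ plays is the right child of $P$; rounds Alice loses are leaves. The right parent of a node $Q$ is the parent of the closest ancestor of $Q$ (with $Q$ its own ancestor) that is a right child; it does not exist if no ancestor of $Q$ is a right child. -}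

module Defs where

open import Data.Nat using (ℕ; zero; suc; _<_; _<?_)
open import Data.Bool using (Bool; true; false)
open import Data.List using (List; []; _∷_; _++_)
open import Data.List.Membership.Propositional using (_∈_)
open import Data.Product using (Σ; ∃; _×_; _,_; proj₁)
open import Data.Sum using (_⊎_)
open import Relation.Nullary using (¬_; yes; no)
open import Relation.Binary.PropositionalEquality using (_≡_)

-- A state of the game: Alice's hand and Bob's hand, top card first.
-- Each card in Bob's hand carries a flag: true iff the card was put into
-- his hand by a putback, i.e. it is a card Bob won.
State : Set
State = List ℕ × List (ℕ × Bool)

-- One round of War with WL-putback (cards are distinct, so no ties).
-- If a player has no cards the game is over and the state no longer changes.
step : State → State
step (a ∷ as , (b , w) ∷ bs) with b <? a
... | yes _ = (as ++ a ∷ b ∷ [] , bs)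
... | no  _ = (as , bs ++ (b , true) ∷ (a , true) ∷ [])
step s = s

run : ℕ → State → State
run zero    s = s
run (suc t) s = run t (step s)

unflag : List ℕ → List (ℕ × Bool)
unflag []       = []
unflag (b ∷ bs) = (b , false) ∷ unflag bs

module Game (A₀ B₀ : List ℕ) where

  stateAt : ℕ → State
  stateAt t = run t (A₀ , unflag B₀)

  Plays : ℕ → ℕ → ℕ → Bool → Set
  Plays t a b w = Σ (List ℕ) λ as → Σ (List (ℕ × Bool)) λ bs →
                  stateAt t ≡ (a ∷ as , (b , w) ∷ bs)

  AlicePlays : ℕ → ℕ → Set
  AlicePlays t x = Σ ℕ λ b → Σ Bool λ w → Plays t x b w

  BobPlays : ℕ → ℕ → Set
  BobPlays t y = Σ ℕ λ a → Σ Bool λ w → Plays t a y w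

  PlaysCard : ℕ → ℕ → Set
  PlaysCard t c = AlicePlays t c ⊎ BobPlays t c

  AliceEmptyAt : ℕ → Set
  AliceEmptyAt r = proj₁ (stateAt r) ≡ []

  SingleUse : Set
  SingleUse = Σ ℕ λ r → AliceEmptyAt r ×
              (∀ t → t < r → ∀ a b w → Plays t a b w → w ≡ false)

  NextPlay : ℕ → ℕ → ℕ → Set
  NextPlay P c Q = P < Q × PlaysCard Q c × (∀ t → P < t → t < Q → ¬ PlaysCard t c)

  FirstPlay : ℕ → ℕ → Set
  FirstPlay c Q = PlaysCard Q c × (∀ t → t < Q → ¬ PlaysCard t c)

  AliceWins : ℕ → ℕ → ℕ → Set
  AliceWins P x y = Σ Bool λ w → Plays P x y w × y < x

  IsRoot : ℕ → Set
  IsRoot Q = Σ ℕ λ x → x ∈ A₀ × FirstPlay x Q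

  LeftChild : ℕ → ℕ → Set
  LeftChild Q P = Σ ℕ λ x → Σ ℕ λ y → AliceWins P x y × NextPlay P x Q

  RightChild : ℕ → ℕ → Set
  RightChild Q P = Σ ℕ λ x → Σ ℕ λ y → AliceWins P x y × NextPlay P y Q

  Child : ℕ → ℕ → Set
  Child Q P = LeftChild Q P ⊎ RightChild Q P

  data RightParent : ℕ → ℕ → Set where
    here : ∀ {Q P} → RightChild Q P → RightParent Q P
    up   : ∀ {Q P′ P} → LeftChild Q P′ → RightParent P′ P → RightParent Q P

  data RootOf : ℕ → ℕ → Set where
    root : ∀ {Q} → IsRoot Q → RootOf Q Q
    up   : ∀ {Q P R} → Child Q P → RootOf P R → RootOf Q R

  HEdgeAt : ℕ → ℕ → ℕ → Set
  HEdgeAt Q y z =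
    BobPlays Q y ×
    ( (Σ ℕ λ P → RightParent Q P × BobPlays P z)
    ⊎ ((¬ Σ ℕ λ P → RightParent Q P) ×
       (Σ ℕ λ R → RootOf Q R × z ∈ A₀ × FirstPlay z R)))

  SamePair : ℕ → ℕ → ℕ → ℕ → Set
  SamePair u v y z = (u ≡ y × v ≡ z) ⊎ (u ≡ z × v ≡ y)

  HEdge : ℕ → ℕ → Set
  HEdge u v = Σ ℕ λ Q → Σ ℕ λ y → Σ ℕ λ z → HEdgeAt Q y z × SamePair u v y z

  GameEdge : ℕ → ℕ → Set
  GameEdge u v = Σ ℕ λ R → Σ ℕ λ a → Σ ℕ λ b → Σ Bool λ w →
                 Plays R a b w × SamePair u v a b

{-# OPTIONS --safe #-}
-- Under single-use Bob plays the cards of his initial hand in order, each once, so a card played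
-- a second time is played by Alice; and a card played in a round Alice loses is never played
-- again.  Hence the parent of a round R is the previous round in which Alice's card a of R was
-- played, and R is its left or right child according as a was Alice's or Bob's card there.
-- Walking up from R through left children keeps Alice's card a, until a right child is met,
-- whose parent has Bob's card a, or a root, whose card from A₀ is a.  So the card H joins to
-- Bob's card of R is Alice's card of R, and every game edge arises this way.

module Submission where

open import Defs
open import Data.Nat using (ℕ; zero; suc; _≤_; _<_; _≤′_; ≤′-refl; ≤′-step; _<?_; _≟_)
open import Data.Nat.Properties
  using (suc-injective; n<1+n; m<n⇒m<1+n; m<1+n⇒m<n∨m≡n; <-cmp; <⇒≱; ≤-pred; ≮⇒≥;
         ≤⇒≤′; z≤′n; ≤′⇒≤)
open import Data.Nat.Induction using (<-rec)
open import Data.Bool using (Bool; true; false)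
open import Data.List using (List; []; _∷_; _++_; map; upTo; length; drop)
open import Data.List.Properties using (++-assoc; ++-identityʳ; map-++)
open import Data.List.Membership.Propositional using (_∈_; _∉_)
open import Data.List.Membership.Propositional.Properties using (∈-++⁺ˡ; ∈-++⁺ʳ; ∈-++⁻)
open import Data.List.Relation.Unary.Any using (here; there)
open import Data.List.Relation.Unary.All as All using (All; []; _∷_)
open import Data.List.Relation.Unary.All.Properties using () renaming (++⁺ to All-++⁺)
open import Data.List.Relation.Unary.Unique.Propositional using (Unique; _∷_)
open import Data.List.Relation.Unary.Unique.Propositional.Properties
  using (map⁺; upTo⁺; Unique[x∷xs]⇒x∉xs)
open import Data.List.Relation.Binary.Permutation.Propositional
  using (_↭_; ↭-refl; ↭-sym; ↭-prep; ↭-swap; ↭⇒↭ₛ; module PermutationReasoning)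
open import Data.List.Relation.Binary.Permutation.Propositional.Properties using (shift; ++-comm; ++⁺ˡ)
open import Data.List.Relation.Binary.Sublist.Propositional.Properties
  using (drop⁺-≥; drop-⊆; Any-resp-⊆)
open import Data.Product using (Σ; _×_; _,_; proj₁; proj₂)
open import Data.Sum using (_⊎_; inj₁; inj₂; [_,_]′)
open import Data.Empty using (⊥; ⊥-elim)
open import Function using (_∘_)
open import Function.Bundles using (_⇔_; mk⇔)
open import Relation.Nullary using (¬_; Dec; yes; no)
open import Relation.Binary.Definitions using (tri<; tri≈; tri>)
open import Relation.Binary.PropositionalEquality
  using (_≡_; _≢_; refl; sym; trans; cong; subst; setoid)
open import Data.List.Relation.Binary.Permutation.Setoid.Properties (setoid ℕ) using (Unique-resp-↭)

Unique-resp-↭ₚ : ∀ {xs ys : List ℕ} → xs ↭ ys → Unique xs → Unique ys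
Unique-resp-↭ₚ = Unique-resp-↭ ∘ ↭⇒↭ₛ

Unique-++⇒disjoint : ∀ {A : Set} (xs : List A) {ys x} → Unique (xs ++ ys) → x ∈ xs → x ∉ ys
Unique-++⇒disjoint (_ ∷ xs) (z∉ ∷ _) (here refl) x∈ys = All.lookup z∉ (∈-++⁺ʳ xs x∈ys) refl
Unique-++⇒disjoint (_ ∷ xs) (_ ∷ u) (there x∈xs) x∈ys = Unique-++⇒disjoint xs u x∈xs x∈ys

∈-drop-antitone : ∀ {A : Set} {m n x} {xs : List A} → m ≤ n → x ∈ drop n xs → x ∈ drop m xs
∈-drop-antitone m≤n = Any-resp-⊆ (drop⁺-≥ m≤n)

∈-drop⇒∈ : ∀ {A : Set} n {x} {xs : List A} → x ∈ drop n xs → x ∈ xs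
∈-drop⇒∈ n {xs = xs} = Any-resp-⊆ (drop-⊆ n xs)

map-proj₁-unflag : ∀ bs → map proj₁ (unflag bs) ≡ bs
map-proj₁-unflag []       = refl
map-proj₁-unflag (b ∷ bs) = cong (b ∷_) (map-proj₁-unflag bs)

quiet-suc : ∀ {P : ℕ → Set} {t S} → (t < S → ¬ P t) → ¬ P S → t < suc S → ¬ P t
quiet-suc quiet ¬PS t<1+S with m<1+n⇒m<n∨m≡n t<1+S
... | inj₁ t<S  = quiet t<S
... | inj₂ refl = ¬PS

cards : State → List ℕ
cards (as , bs) = as ++ map proj₁ bs

Round : State → ℕ → ℕ → Bool → Set
Round s a b w = Σ (List ℕ) λ as → Σ (List (ℕ × Bool)) λ bs → s ≡ (a ∷ as , (b , w) ∷ bs)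

round-or-idle : ∀ s → (Σ ℕ λ a → Σ ℕ λ b → Σ Bool λ w → Round s a b w)
                    ⊎ (step s ≡ s × ∀ {a b w} → ¬ Round s a b w)
round-or-idle ([] , bs)               = inj₂ (refl , λ { (_ , _ , ()) })
round-or-idle (a ∷ as , [])           = inj₂ (refl , λ { (_ , _ , ()) })
round-or-idle (a ∷ as , (b , w) ∷ bs) = inj₁ (a , b , w , as , bs , refl)

step-↭ : ∀ s → cards (step s) ↭ cards s
step-↭ ([] , bs)               = ↭-refl
step-↭ (a ∷ as , [])           = ↭-refl
step-↭ (a ∷ as , (b , w) ∷ bs) with b <? a
... | yes _ = begin
  (as ++ a ∷ b ∷ []) ++ B ≡⟨ ++-assoc as (a ∷ b ∷ []) B ⟩
  as ++ a ∷ b ∷ B         ↭⟨ shift a as (b ∷ B) ⟩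
  a ∷ as ++ b ∷ B         ∎
  where open PermutationReasoning
        B = map proj₁ bs
... | no _ = begin
  as ++ map proj₁ (bs ++ (b , true) ∷ (a , true) ∷ []) ≡⟨ cong (as ++_) (map-++ proj₁ bs _) ⟩
  as ++ B ++ b ∷ a ∷ []                                ↭⟨ ++⁺ˡ as (++-comm B (b ∷ a ∷ [])) ⟩
  as ++ b ∷ a ∷ B                                      ↭⟨ ++⁺ˡ as (↭-swap b a ↭-refl) ⟩
  as ++ a ∷ b ∷ B                                      ↭⟨ shift a as (b ∷ B) ⟩
  a ∷ as ++ b ∷ B                                      ∎
  where open PermutationReasoning
        B = map proj₁ bs

step-alice : ∀ s {c} → c ∈ proj₁ (step s) →
             c ∈ proj₁ s ⊎ Σ ℕ λ a → Σ ℕ λ b → Σ Bool λ w → Round s a b w × (c ≡ a ⊎ c ≡ b)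
step-alice ([] , bs) c∈               = inj₁ c∈
step-alice (a ∷ as , []) c∈           = inj₁ c∈
step-alice (a ∷ as , (b , w) ∷ bs) c∈ with b <? a
... | no _  = inj₁ (there c∈)
... | yes _ with ∈-++⁻ as c∈
...   | inj₁ c∈as                = inj₁ (there c∈as)
...   | inj₂ (here c≡a)          = inj₂ (a , b , w , (as , bs , refl) , inj₁ c≡a)
...   | inj₂ (there (here c≡b))  = inj₂ (a , b , w , (as , bs , refl) , inj₂ c≡b)

step-alice-loses : ∀ {a as b w bs} → ¬ b < a → proj₁ (step (a ∷ as , (b , w) ∷ bs)) ≡ as
step-alice-loses {a} {b = b} b≮a with b <? a
... | yes b<a = ⊥-elim (b≮a b<a)
... | no _    = refl

step-bob : ∀ a as b w bs → proj₂ (step (a ∷ as , (b , w) ∷ bs)) ≡ bs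
                         ⊎ proj₂ (step (a ∷ as , (b , w) ∷ bs)) ≡ bs ++ (b , true) ∷ (a , true) ∷ []
step-bob a as b w bs with b <? a
... | yes _ = inj₁ refl
... | no _  = inj₂ refl

run-suc : ∀ t s → run (suc t) s ≡ step (run t s)
run-suc zero    s = refl
run-suc (suc t) s = run-suc t (step s)

module WarGame (A₀ B₀ : List ℕ) where
  open Game A₀ B₀

  Alice : ℕ → List ℕ
  Alice t = proj₁ (stateAt t)

  stateAt-suc : ∀ t → stateAt (suc t) ≡ step (stateAt t)
  stateAt-suc t = run-suc t (A₀ , unflag B₀)

  plays-deterministic : ∀ t {a b w a′ b′ w′} → Plays t a b w → Plays t a′ b′ w′ →
                        a ≡ a′ × b ≡ b′
  plays-deterministic _ (_ , _ , e) (_ , _ , e′) with trans (sym e) e′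
  ... | refl = refl , refl

  played-card : ∀ t {a b w c} → Plays t a b w → PlaysCard t c → c ≡ a ⊎ c ≡ b
  played-card t pl (inj₁ (_ , _ , pl′)) = inj₁ (proj₁ (plays-deterministic t pl′ pl))
  played-card t pl (inj₂ (_ , _ , pl′)) = inj₂ (proj₂ (plays-deterministic t pl′ pl))

  previous-round : ∀ t {a b w} → Plays (suc t) a b w →
                   Σ ℕ λ a′ → Σ ℕ λ b′ → Σ Bool λ w′ → Plays t a′ b′ w′
  previous-round t (as , bs , e) with round-or-idle (stateAt t)
  ... | inj₁ r          = r
  ... | inj₂ (idle , _) = _ , _ , _ , as , bs , trans (sym idle) (trans (sym (stateAt-suc t)) e)

  alice-empty-persists : ∀ {s t} → AliceEmptyAt s → s ≤′ t → AliceEmptyAt t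
  alice-empty-persists e ≤′-refl = e
  alice-empty-persists {t = suc t} e (≤′-step s≤′t) =
    cong proj₁ (trans (stateAt-suc t)
                      (cong (λ as → step (as , proj₂ (stateAt t))) (alice-empty-persists e s≤′t)))

  alice-card-in-hand : ∀ t {a b w} → Plays t a b w → a ∈ Alice t
  alice-card-in-hand _ (_ , _ , e) = subst (λ s → _ ∈ proj₁ s) (sym e) (here refl)

  alice-hand-step : ∀ t {c} → c ∈ Alice (suc t) → c ∈ Alice t ⊎ PlaysCard t c
  alice-hand-step t {c} c∈ with step-alice (stateAt t) (subst (λ s → c ∈ proj₁ s) (stateAt-suc t) c∈)
  ... | inj₁ c∈′                         = inj₁ c∈′
  ... | inj₂ (a , b , w , r , inj₁ refl) = inj₂ (inj₁ (b , w , r))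
  ... | inj₂ (a , b , w , r , inj₂ refl) = inj₂ (inj₂ (a , w , r))

  -- A card enters Alice's hand only as one of the two cards of a round.
  alice-hand-backward : ∀ {s R c} → s ≤′ R → (∀ t → s ≤ t → t < R → ¬ PlaysCard t c) →
                        c ∈ Alice R → c ∈ Alice s
  alice-hand-backward ≤′-refl _ c∈ = c∈
  alice-hand-backward {R = suc R} (≤′-step s≤′R) quiet c∈ with alice-hand-step R c∈
  ... | inj₁ c∈′ = alice-hand-backward s≤′R (λ t s≤t t<R → quiet t s≤t (m<n⇒m<1+n t<R)) c∈′
  ... | inj₂ pc  = ⊥-elim (quiet R (≤′⇒≤ s≤′R) (n<1+n R) pc)

  playsCard? : ∀ t c → Dec (PlaysCard t c)
  playsCard? t c with round-or-idle (stateAt t)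
  ... | inj₂ (_ , not-round) =
    no λ { (inj₁ (_ , _ , r)) → not-round r ; (inj₂ (_ , _ , r)) → not-round r }
  ... | inj₁ (a , b , w , r) with c ≟ a | c ≟ b
  ...   | yes refl | _        = yes (inj₁ (b , w , r))
  ...   | no _     | yes refl = yes (inj₂ (a , w , r))
  ...   | no c≢a   | no c≢b   = no (λ pc → [ c≢a , c≢b ]′ (played-card t r pc))

  last-play-below : ∀ S c →
    (∀ t → t < S → ¬ PlaysCard t c) ⊎
    Σ ℕ λ P → P < S × PlaysCard P c × (∀ t → P < t → t < S → ¬ PlaysCard t c)
  last-play-below zero c = inj₁ (λ _ ())
  last-play-below (suc S) c with playsCard? S c
  ... | yes pc = inj₂ (S , n<1+n S , pc , λ t S<t t<1+S → ⊥-elim (<⇒≱ S<t (≤-pred t<1+S)))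
  ... | no ¬pc with last-play-below S c
  ...   | inj₁ never                = inj₁ (λ t → quiet-suc (never t) ¬pc)
  ...   | inj₂ (P , P<S , pc , gap) =
          inj₂ (P , m<n⇒m<1+n P<S , pc , λ t P<t → quiet-suc (gap t P<t) ¬pc)

  NextPlay-unique : ∀ {P P′ c R} → PlaysCard P c → NextPlay P c R →
                    PlaysCard P′ c → NextPlay P′ c R → P ≡ P′
  NextPlay-unique {P} {P′} pc (P<R , _ , gap) pc′ (P′<R , _ , gap′) with <-cmp P P′
  ... | tri< P<P′ _ _ = ⊥-elim (gap P′ P<P′ P′<R pc′)
  ... | tri≈ _ P≡P′ _ = P≡P′
  ... | tri> _ _ P′<P = ⊥-elim (gap′ P P′<P P<R pc)

  SamePair-swap : ∀ {u v y z} → SamePair u v y z → SamePair u v z y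
  SamePair-swap (inj₁ p) = inj₂ p
  SamePair-swap (inj₂ p) = inj₁ p

  module Distinct (distinct : Unique (A₀ ++ B₀)) where

    unique-cards : ∀ t → Unique (cards (stateAt t))
    unique-cards zero    = subst (λ B → Unique (A₀ ++ B)) (sym (map-proj₁-unflag B₀)) distinct
    unique-cards (suc t) = subst (Unique ∘ cards) (sym (stateAt-suc t))
                                 (Unique-resp-↭ₚ (↭-sym (step-↭ (stateAt t))) (unique-cards t))

    round-unique : ∀ t {a as b w bs} → stateAt t ≡ (a ∷ as , (b , w) ∷ bs) →
                   Unique (a ∷ b ∷ as ++ map proj₁ bs)
    round-unique t {a} {as} {b} {bs = bs} e =
      Unique-resp-↭ₚ (↭-prep a (shift b as (map proj₁ bs)))
                     (subst (Unique ∘ cards) e (unique-cards t))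

    played-card-unique : ∀ {a b c : ℕ} {L} → Unique (a ∷ b ∷ L) → c ≡ a ⊎ c ≡ b → c ∉ L
    played-card-unique u       (inj₁ refl) c∈L = Unique[x∷xs]⇒x∉xs u (there c∈L)
    played-card-unique (_ ∷ u) (inj₂ refl)     = Unique[x∷xs]⇒x∉xs u

    alice≢bob : ∀ t {a b w} → Plays t a b w → a ≢ b
    alice≢bob t (_ , _ , e) refl = Unique[x∷xs]⇒x∉xs (round-unique t e) (here refl)

    lost-card-not-returned : ∀ P {a b w c R} → Plays P a b w → ¬ b < a → PlaysCard P c → P < R →
                             (∀ t → P < t → t < R → ¬ PlaysCard t c) → c ∉ Alice R
    lost-card-not-returned P {w = w} {c = c} (as , bs , e) b≮a pc P<R gap c∈ =
      played-card-unique (round-unique P e) (played-card P (as , bs , e) pc) (∈-++⁺ˡ c∈as)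
      where
      Alice-after : Alice (suc P) ≡ as
      Alice-after = trans (cong proj₁ (trans (stateAt-suc P) (cong step e)))
                          (step-alice-loses {w = w} b≮a)
      c∈as : c ∈ as
      c∈as = subst (c ∈_) Alice-after (alice-hand-backward (≤⇒≤′ P<R) gap c∈)

    module SingleUseGame (single-use : SingleUse) where

      alice-empty-from-end : ∀ {t} → proj₁ single-use ≤ t → AliceEmptyAt t
      alice-empty-from-end r≤t = alice-empty-persists (proj₁ (proj₂ single-use)) (≤⇒≤′ r≤t)

      round-before-end : ∀ t {a b w} → Plays t a b w → t < proj₁ single-use
      round-before-end t (_ , _ , e) with t <? proj₁ single-use
      ... | yes t<r = t<r
      ... | no t≮r with trans (sym (alice-empty-from-end (≮⇒≥ t≮r))) (cong proj₁ e)
      ...   | ()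

      bob-plays-unwon : ∀ t {a b w} → Plays t a b w → w ≡ false
      bob-plays-unwon t pl = proj₂ (proj₂ single-use) _ (round-before-end t pl) _ _ _ pl

      Won : ℕ × Bool → Set
      Won p = proj₂ p ≡ true

      -- Single-use keeps the cards Bob wins below the unplayed cards of B₀,
      -- so in round t he plays the t-th card of B₀.
      BobHand : ℕ → List (ℕ × Bool) → Set
      BobHand t hand = Σ (List (ℕ × Bool)) λ W → All Won W × hand ≡ unflag (drop t B₀) ++ W

      BobHand-++ : ∀ {t hand X} → All Won X → BobHand t hand → BobHand t (hand ++ X)
      BobHand-++ {t} {X = X} wonX (W , wonW , e) =
        W ++ X , All-++⁺ wonW wonX , trans (cong (_++ X) e) (++-assoc (unflag (drop t B₀)) W X)

      BobHand-⊇ : ∀ {t hand x} → BobHand t hand → x ∈ drop t B₀ → x ∈ map proj₁ hand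
      BobHand-⊇ {t} {x = x} (W , _ , refl) x∈ =
        subst (x ∈_) (sym (map-++ proj₁ (unflag (drop t B₀)) W))
              (∈-++⁺ˡ (subst (x ∈_) (sym (map-proj₁-unflag (drop t B₀))) x∈))

      pop-unwon : ∀ t (D : List ℕ) {W b bs} → All Won W →
                  (b , false) ∷ bs ≡ unflag (drop t D) ++ W →
                  drop t D ≡ b ∷ drop (suc t) D × bs ≡ unflag (drop (suc t) D) ++ W
      pop-unwon zero    []      (() ∷ _) refl
      pop-unwon zero    (d ∷ D) _        refl = refl , refl
      pop-unwon (suc t) []      (() ∷ _) refl
      pop-unwon (suc t) (d ∷ D) won      e    = pop-unwon t D won e

      bob-pops : ∀ t {a as b w bs} → stateAt t ≡ (a ∷ as , (b , w) ∷ bs) →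
                 BobHand t ((b , w) ∷ bs) → drop t B₀ ≡ b ∷ drop (suc t) B₀ × BobHand (suc t) bs
      bob-pops t e (W , won , hand) with bob-plays-unwon t (_ , _ , e)
      ... | refl with pop-unwon t B₀ won hand
      ...   | drop≡ , rest = drop≡ , W , won , rest

      bob-hand : ∀ t {a as b w bs} → stateAt t ≡ (a ∷ as , (b , w) ∷ bs) → BobHand t ((b , w) ∷ bs)
      bob-hand zero e = [] , [] , trans (sym (cong proj₂ e)) (sym (++-identityʳ (unflag B₀)))
      bob-hand (suc t) {bs = bs} e with previous-round t (_ , bs , e)
      ... | a′ , b′ , w′ , as′ , bs′ , e′ with proj₂ (bob-pops t e′ (bob-hand t e′))
      ...   | W , won , hand = subst (BobHand (suc t)) hand≡ (after (step-bob a′ as′ b′ w′ bs′))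
        where
        hand≡ : proj₂ (step (a′ ∷ as′ , (b′ , w′) ∷ bs′)) ≡ (_ , _) ∷ bs
        hand≡ = trans (sym (cong proj₂ (trans (stateAt-suc t) (cong step e′)))) (cong proj₂ e)
        after : ∀ {hand′} → hand′ ≡ bs′ ⊎ hand′ ≡ bs′ ++ (b′ , true) ∷ (a′ , true) ∷ [] →
                BobHand (suc t) hand′
        after (inj₁ refl) = W , won , hand
        after (inj₂ refl) = BobHand-++ {suc t} (refl ∷ refl ∷ []) (W , won , hand)

      bob-round : ∀ t {a as b w bs} → stateAt t ≡ (a ∷ as , (b , w) ∷ bs) →
                  drop t B₀ ≡ b ∷ drop (suc t) B₀ × BobHand (suc t) bs
      bob-round t e = bob-pops t e (bob-hand t e)

      bob-card-∈ : ∀ t {a b w} → Plays t a b w → b ∈ drop t B₀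
      bob-card-∈ t (_ , _ , e) = subst (_ ∈_) (sym (proj₁ (bob-round t e))) (here refl)

      round-card-not-ahead : ∀ t {a as b w bs c} → stateAt t ≡ (a ∷ as , (b , w) ∷ bs) →
                             c ≡ a ⊎ c ≡ b → c ∉ drop (suc t) B₀
      round-card-not-ahead t {as = as} e c∈ab c∈ =
        played-card-unique (round-unique t e) c∈ab
          (∈-++⁺ʳ as (BobHand-⊇ {suc t} (proj₂ (bob-round t e)) c∈))

      played-card-not-ahead : ∀ t {c} → PlaysCard t c → c ∉ drop (suc t) B₀
      played-card-not-ahead t (inj₁ (_ , _ , _ , _ , e)) = round-card-not-ahead t e (inj₁ refl)
      played-card-not-ahead t (inj₂ (_ , _ , _ , _ , e)) = round-card-not-ahead t e (inj₂ refl)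

      bob-card-unplayed-before : ∀ P R {a b w} → Plays R a b w → P < R → ¬ PlaysCard P b
      bob-card-unplayed-before P R pl P<R pc =
        played-card-not-ahead P pc (∈-drop-antitone P<R (bob-card-∈ R pl))

      bob-card-∉A₀ : ∀ R {a b w} → Plays R a b w → b ∉ A₀
      bob-card-∉A₀ R pl b∈A₀ =
        Unique-++⇒disjoint A₀ distinct b∈A₀ (∈-drop⇒∈ R (bob-card-∈ R pl))

      replayed-card-is-Alice's : ∀ {P R c} → PlaysCard P c → P < R → PlaysCard R c → AlicePlays R c
      replayed-card-is-Alice's _ _ (inj₁ ap) = ap
      replayed-card-is-Alice's {P} {R} pc P<R (inj₂ (_ , _ , pl)) =
        ⊥-elim (bob-card-unplayed-before P R pl P<R pc)

      carried-card-is-Alice's : ∀ {P R c} → PlaysCard P c → NextPlay P c R → AlicePlays R c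
      carried-card-is-Alice's pc (P<R , pcR , _) = replayed-card-is-Alice's pc P<R pcR

      child-card : ∀ {R P} → Child R P → Σ ℕ λ c → PlaysCard P c × NextPlay P c R
      child-card (inj₁ (x , y , (w , pl , _) , nx)) = x , inj₁ (y , w , pl) , nx
      child-card (inj₂ (x , y , (w , pl , _) , nx)) = y , inj₂ (x , w , pl) , nx

      parent-card : ∀ {R P a b w} → Plays R a b w → Child R P → PlaysCard P a × NextPlay P a R
      parent-card {R} pl ch with child-card ch
      ... | c , pc , nx with carried-card-is-Alice's pc nx
      ...   | _ , _ , pl′ with plays-deterministic R pl′ pl
      ...     | refl , _ = pc , nx

      parent-unique : ∀ {R P P′} → Child R P → Child R P′ → P ≡ P′
      parent-unique ch ch′ with child-card ch
      ... | c , pc , nx with carried-card-is-Alice's pc nx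
      ...   | _ , _ , pl with parent-card pl ch | parent-card pl ch′
      ...     | pcP , nxP | pcP′ , nxP′ = NextPlay-unique pcP nxP pcP′ nxP′

      left-not-right : ∀ {R P} → LeftChild R P → RightChild R P → ⊥
      left-not-right {R} {P} (x , y , (w , pl , _) , nx) (x′ , y′ , (w′ , pl′ , _) , nx′)
        with carried-card-is-Alice's (inj₁ (y , w , pl)) nx
           | carried-card-is-Alice's (inj₂ (x′ , w′ , pl′)) nx′
      ... | _ , _ , plR | _ , _ , plR′ with plays-deterministic R plR plR′ | plays-deterministic P pl pl′
      ...   | refl , _ | _ , refl = alice≢bob P pl refl

      rightParent-of-leftChild : ∀ {R P Q} → LeftChild R P → RightParent R Q → RightParent P Q
      rightParent-of-leftChild lc (here rc) with parent-unique (inj₁ lc) (inj₂ rc)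
      ... | refl = ⊥-elim (left-not-right lc rc)
      rightParent-of-leftChild lc (up lc′ rp) with parent-unique (inj₁ lc) (inj₁ lc′)
      ... | refl = rp

      rightParent⇒child : ∀ {R Q} → RightParent R Q → Σ ℕ λ P → Child R P
      rightParent⇒child (here rc)  = _ , inj₂ rc
      rightParent⇒child (up lc _) = _ , inj₁ lc

      Anchor : ℕ → ℕ → Set
      Anchor R z =
        (Σ ℕ λ P → RightParent R P × BobPlays P z) ⊎
        ((¬ Σ ℕ λ P → RightParent R P) × (Σ ℕ λ Q → RootOf R Q × z ∈ A₀ × FirstPlay z Q))

      leftChild-carries : ∀ {R P z} → LeftChild R P → AlicePlays P z → AlicePlays R z
      leftChild-carries {P = P} (x , y , (w , pl , _) , nx) (_ , _ , pl′)
        with plays-deterministic P pl′ pl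
      ... | refl , _ = carried-card-is-Alice's (inj₁ (y , w , pl)) nx

      rightChild-carries : ∀ {R P z} → RightChild R P → BobPlays P z → AlicePlays R z
      rightChild-carries {P = P} (x , y , (w , pl , _) , nx) (_ , _ , pl′)
        with plays-deterministic P pl′ pl
      ... | _ , refl = carried-card-is-Alice's (inj₂ (x , w , pl)) nx

      rightParent-carries : ∀ {R P z} → RightParent R P → BobPlays P z → AlicePlays R z
      rightParent-carries (here rc)  = rightChild-carries rc
      rightParent-carries (up lc rp) = leftChild-carries lc ∘ rightParent-carries rp

      root-carries : ∀ {R Q z} → ¬ (Σ ℕ λ P → RightParent R P) → RootOf R Q →
                     z ∈ A₀ → FirstPlay z Q → AlicePlays R z
      root-carries _ (root _) _ (inj₁ ap , _) = ap
      root-carries {R} _ (root _) z∈A₀ (inj₂ (_ , _ , pl) , _) = ⊥-elim (bob-card-∉A₀ R pl z∈A₀)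
      root-carries noRP (up (inj₁ lc) ro) z∈A₀ first =
        leftChild-carries lc (root-carries (λ { (Q , rp) → noRP (Q , up lc rp) }) ro z∈A₀ first)
      root-carries noRP (up (inj₂ rc) _) _ _ = ⊥-elim (noRP (_ , here rc))

      anchor⇒AlicePlays : ∀ {R z} → Anchor R z → AlicePlays R z
      anchor⇒AlicePlays (inj₁ (_ , rp , bp))                  = rightParent-carries rp bp
      anchor⇒AlicePlays (inj₂ (noRP , _ , ro , z∈A₀ , first)) = root-carries noRP ro z∈A₀ first

      leftChild-anchor : ∀ {R P a} → LeftChild R P → Anchor P a → Anchor R a
      leftChild-anchor lc (inj₁ (Q , rp , bp)) = inj₁ (Q , up lc rp , bp)
      leftChild-anchor lc (inj₂ (noRP , Q , ro , a∈A₀ , first)) =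
        inj₂ ( (λ { (Q′ , rp) → noRP (Q′ , rightParent-of-leftChild lc rp) })
             , Q , up (inj₁ lc) ro , a∈A₀ , first)

      first-play-anchor : ∀ {R a b w} → Plays R a b w → (∀ t → t < R → ¬ PlaysCard t a) → Anchor R a
      first-play-anchor {R} {a} {b} {w} pl never =
        inj₂ (no-right-parent , R , root (a , a∈A₀ , first) , a∈A₀ , first)
        where
        first : FirstPlay a R
        first = inj₁ (b , w , pl) , never
        a∈A₀ : a ∈ A₀
        a∈A₀ = alice-hand-backward z≤′n (λ t _ → never t) (alice-card-in-hand R pl)
        no-right-parent : ¬ Σ ℕ λ Q → RightParent R Q
        no-right-parent (_ , rp) with rightParent⇒child rp
        ... | P , ch with parent-card pl ch
        ...   | pc , (P<R , _) = never P P<R pc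

      AliceCardAnchored : ℕ → Set
      AliceCardAnchored R = ∀ {a b w} → Plays R a b w → Anchor R a

      -- Induction on the previous round P in which Alice's card a of R was played: if Alice
      -- lost P, then a never returned to her hand; if she won it, R is a child of P.
      anchor-step : ∀ R → (∀ {P} → P < R → AliceCardAnchored P) → AliceCardAnchored R
      anchor-step R ih {a} {b} {w} pl with last-play-below R a
      ... | inj₁ never = first-play-anchor pl never
      ... | inj₂ (P , P<R , inj₁ (b′ , w′ , plP) , gap) with b′ <? a
      ...   | yes b′<a =
              leftChild-anchor (a , b′ , (w′ , plP , b′<a) , (P<R , inj₁ (b , w , pl) , gap)) (ih P<R plP)
      ...   | no b′≮a =
              ⊥-elim (lost-card-not-returned P plP b′≮a (inj₁ (b′ , w′ , plP)) P<R gap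
                                              (alice-card-in-hand R pl))
      anchor-step R ih {a} {b} {w} pl | inj₂ (P , P<R , inj₂ (x , w′ , plP) , gap) with a <? x
      ...   | yes a<x =
              inj₁ (P , here (x , a , (w′ , plP , a<x) , (P<R , inj₁ (b , w , pl) , gap)) , (x , w′ , plP))
      ...   | no a≮x =
              ⊥-elim (lost-card-not-returned P plP a≮x (inj₂ (x , w′ , plP)) P<R gap
                                              (alice-card-in-hand R pl))

      alice-card-anchored : ∀ R → AliceCardAnchored R
      alice-card-anchored = <-rec AliceCardAnchored anchor-step

      HEdge⇒GameEdge : ∀ {u v} → HEdge u v → GameEdge u v
      HEdge⇒GameEdge (Q , y , z , ((_ , _ , plBob) , anchor) , same) with anchor⇒AlicePlays anchor
      ... | _ , w , pl with plays-deterministic Q pl plBob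
      ...   | _ , refl = Q , z , y , w , pl , SamePair-swap same

      GameEdge⇒HEdge : ∀ {u v} → GameEdge u v → HEdge u v
      GameEdge⇒HEdge (R , a , b , w , pl , same) =
        R , b , a , ((a , w , pl) , alice-card-anchored R pl) , SamePair-swap same

theorem4p6 : (n m : ℕ) (A₀ B₀ : List ℕ) →
    (A₀ ++ B₀) ↭ map suc (upTo n) →
    length A₀ ≡ m →
    Game.SingleUse A₀ B₀ →
    (u v : ℕ) → (Game.HEdge A₀ B₀ u v ⇔ Game.GameEdge A₀ B₀ u v)
theorem4p6 n m A₀ B₀ deal _ single-use u v = mk⇔ HEdge⇒GameEdge GameEdge⇒HEdge
  where
  distinct : Unique (A₀ ++ B₀)
  distinct = Unique-resp-↭ₚ (↭-sym deal) (map⁺ suc-injective (upTo⁺ n))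
  open WarGame.Distinct.SingleUseGame A₀ B₀ distinct single-use
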